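{- For every maximal matching $M$ of $K(Q_d)$ there is a maximal matching $M'$ of $Q_d$ such that $\ell(M)\ge \ell(M')$.
   Context: $Q_d$ has vertex set all subsets of $[d]$, two sets adjacent iff they differ in one element; $K(Q_d)$ is the complete graph on $V(Q_d)$. The length of an edge $uv$ of $K(Q_d)$ is $\ell(uv)=|u\triangle v|$, and for a set $F$ of edges $\ell(F)=\sum_{e\in F}\ell(e)$. A matching $M$ of $K(Q_d)$ is maximal if it covers at least one end vertex of every edge of $Q_d$. A maximal matching of $Q_d$ is a matching consisting of edges of $Q_d$ that covers at least one end vertex of every edge of $Q_d$. -}

module Defs where

open import Data.Nat using (ℕ; zero; suc; _+_)
open import Data.Bool using (Bool; true; false; if_then_else_)
open import Data.Bool.Properties using () renaming (_≟_ to _≟ᵇ_)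
open import Data.Vec using (Vec; []; _∷_)
open import Data.List using (List; []; _∷_; _++_; concatMap; map)
open import Data.Nat.ListAction using (sum)
open import Data.List.Membership.Propositional using (_∈_)
open import Data.List.Relation.Unary.All using (All)
open import Data.List.Relation.Unary.Unique.Propositional using (Unique)
open import Data.Product using (_×_; _,_; proj₁; proj₂)
open import Data.Sum using (_⊎_)
open import Relation.Binary.PropositionalEquality using (_≡_; _≢_)
open import Relation.Nullary using (yes; no)

-- Vertices of Q_d: subsets of [d], encoded as characteristic vectors.
V : ℕ → Set
V d = Vec Bool d

-- |u △ v| : number of coordinates where u and v differ (Hamming distance).
dist : ∀ {d} → V d → V d → ℕ
dist [] [] = 0
dist (a ∷ u) (b ∷ v) with a ≟ᵇ b
... | yes _ = dist u v
... | no  _ = suc (dist u v)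

-- An edge of K(Q_d) is an unordered pair {u,v}, u ≠ v; represented as an
-- ordered pair (the order is irrelevant to everything below).
Edge : ℕ → Set
Edge d = V d × V d

len : ∀ {d} → Edge d → ℕ
len (u , v) = dist u v

totalLen : ∀ {d} → List (Edge d) → ℕ
totalLen F = sum (map len F)

ends : ∀ {d} → List (Edge d) → List (V d)
ends F = concatMap (λ e → proj₁ e ∷ proj₂ e ∷ []) F

AdjQ : ∀ {d} → V d → V d → Set
AdjQ u v = dist u v ≡ 1

-- A matching of K(Q_d): a list of edges (u ≠ v) whose end vertices are
-- pairwise distinct (so no two edges share a vertex, and no edge repeats).
IsMatchingK : ∀ {d} → List (Edge d) → Set
IsMatchingK M = All (λ e → proj₁ e ≢ proj₂ e) M × Unique (ends M)

CoversQ : ∀ {d} → List (Edge d) → Set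
CoversQ {d} M = (u v : V d) → AdjQ u v → (u ∈ ends M) ⊎ (v ∈ ends M)

IsMaximalMatchingK : ∀ {d} → List (Edge d) → Set
IsMaximalMatchingK M = IsMatchingK M × CoversQ M

IsMaximalMatchingQ : ∀ {d} → List (Edge d) → Set
IsMaximalMatchingQ M = IsMatchingK M × All (λ e → AdjQ (proj₁ e) (proj₂ e)) M × CoversQ M

-- Keep the edges of M of length 1 and extend them greedily, over all edges of
-- Q_d, to a maximal matching M′ of Q_d. Every edge added by the greedy step
-- has two ends not yet covered, and at least one of them is an end of M
-- because M covers the edge; so |M′| + (number of ends of M not covered by M′)
-- never increases. Initially this quantity is #short edges + 2 · #long edges
-- of M, which is at most ℓ(M) since a long edge has length at least 2; at the
-- end it is at least |M′| = ℓ(M′).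
module Submission where

open import Defs
open import Data.Nat using (ℕ; zero; suc; _+_; _≥_; _≤_; _<_; z≤n; s≤s)
open import Data.Nat.Properties
  using (_≟_; ≤-refl; ≤-trans; m≤n⇒m≤1+n; n≤1+n; m≤m+n; +-suc; +-monoʳ-≤; +-monoʳ-<; +-mono-≤; module ≤-Reasoning)
open import Data.Bool using (true; false)
open import Data.Bool.Properties using () renaming (_≟_ to _≟ᵇ_)
open import Data.Vec using ([]; _∷_)
open import Data.Vec.Properties using (≡-dec)
open import Data.List using (List; []; _∷_; _++_; map; length; filter; foldl; cartesianProduct)
open import Data.List.Properties using (filter-accept; filter-reject)
open import Data.List.Relation.Unary.All as All using (All; []; _∷_)
open import Data.List.Relation.Unary.All.Properties using (¬Any⇒All¬; anti-mono; all-filter; filter⁺)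
open import Data.List.Relation.Unary.AllPairs using ([]; _∷_)
open import Data.List.Relation.Unary.Unique.Propositional using (Unique)
open import Data.List.Relation.Unary.Any using (here; there)
open import Data.List.Relation.Binary.Subset.Propositional using (_⊆_)
open import Data.List.Membership.Propositional using (_∈_; _∉_)
open import Data.List.Membership.Propositional.Properties
  using (∈-map⁺; ∈-++⁺ˡ; ∈-++⁺ʳ; ∈-cartesianProduct⁺; ∈-filter⁺)
open import Data.Product using (Σ; _×_; _,_; proj₁; proj₂)
open import Data.Sum using (_⊎_; inj₁; inj₂)
open import Data.Empty using (⊥-elim)
open import Relation.Nullary using (Dec; yes; no; ¬_; ¬?; does; _×-dec_)
open import Relation.Unary using (Decidable)
open import Relation.Binary.PropositionalEquality using (_≡_; _≢_; refl; cong; sym; trans)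

dist-self : ∀ {d} (u : V d) → dist u u ≡ 0
dist-self [] = refl
dist-self (a ∷ u) with a ≟ᵇ a
... | yes _ = dist-self u
... | no a≢a = ⊥-elim (a≢a refl)

dist≡0⇒≡ : ∀ {d} {u v : V d} → dist u v ≡ 0 → u ≡ v
dist≡0⇒≡ {u = []} {[]} _ = refl
dist≡0⇒≡ {u = a ∷ u} {b ∷ v} eq with a ≟ᵇ b
... | yes refl = cong (a ∷_) (dist≡0⇒≡ eq)
... | no _ with eq
...   | ()

adjacent⇒≢ : ∀ {d} {u v : V d} → AdjQ u v → u ≢ v
adjacent⇒≢ {u = u} adj refl with trans (sym adj) (dist-self u)
... | ()

≢∧¬adjacent⇒2≤dist : ∀ {d} {u v : V d} → u ≢ v → ¬ AdjQ u v → 2 ≤ dist u v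
≢∧¬adjacent⇒2≤dist {u = u} {v} u≢v ¬adj with dist u v in eq
... | zero = ⊥-elim (u≢v (dist≡0⇒≡ eq))
... | suc zero = ⊥-elim (¬adj refl)
... | suc (suc _) = s≤s (s≤s z≤n)

vertices : ∀ d → List (V d)
vertices zero = [] ∷ []
vertices (suc d) = map (true ∷_) (vertices d) ++ map (false ∷_) (vertices d)

∈-vertices : ∀ {d} (v : V d) → v ∈ vertices d
∈-vertices [] = here refl
∈-vertices (true ∷ v) = ∈-++⁺ˡ (∈-map⁺ (true ∷_) (∈-vertices v))
∈-vertices {suc d} (false ∷ v) = ∈-++⁺ʳ (map (true ∷_) (vertices d)) (∈-map⁺ (false ∷_) (∈-vertices v))

module _ {d : ℕ} where

  _≟V_ : (u v : V d) → Dec (u ≡ v)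
  _≟V_ = ≡-dec _≟ᵇ_

  open import Data.List.Membership.DecPropositional _≟V_ using (_∈?_)

  ∈⇒proj₁∈ends : ∀ {e : Edge d} {N} → e ∈ N → proj₁ e ∈ ends N
  ∈⇒proj₁∈ends (here refl) = here refl
  ∈⇒proj₁∈ends (there e∈N) = there (there (∈⇒proj₁∈ends e∈N))

  ∈⇒proj₂∈ends : ∀ {e : Edge d} {N} → e ∈ N → proj₂ e ∈ ends N
  ∈⇒proj₂∈ends (here refl) = there (here refl)
  ∈⇒proj₂∈ends (there e∈N) = there (there (∈⇒proj₂∈ends e∈N))

  uncovered : List (V d) → List (V d) → ℕ
  uncovered C [] = 0
  uncovered C (z ∷ zs) with z ∈? C
  ... | yes _ = uncovered C zs
  ... | no _ = suc (uncovered C zs)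

  uncovered-antimono : ∀ {C C′} → C ⊆ C′ → ∀ zs → uncovered C′ zs ≤ uncovered C zs
  uncovered-antimono C⊆C′ [] = z≤n
  uncovered-antimono {C} {C′} C⊆C′ (z ∷ zs) with z ∈? C | z ∈? C′
  ... | yes z∈C | no z∉C′ = ⊥-elim (z∉C′ (C⊆C′ z∈C))
  ... | yes _ | yes _ = uncovered-antimono C⊆C′ zs
  ... | no _ | yes _ = m≤n⇒m≤1+n (uncovered-antimono C⊆C′ zs)
  ... | no _ | no _ = s≤s (uncovered-antimono C⊆C′ zs)

  uncovered-strict : ∀ {C C′ z} → C ⊆ C′ → ∀ zs → z ∈ zs → z ∉ C → z ∈ C′ →
                     uncovered C′ zs < uncovered C zs
  uncovered-strict {C} {C′} C⊆C′ (y ∷ zs) z∈zs z∉C z∈C′ with y ∈? C | y ∈? C′ | z∈zs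
  ... | yes y∈C | no y∉C′ | _ = ⊥-elim (y∉C′ (C⊆C′ y∈C))
  ... | yes y∈C | yes _ | here refl = ⊥-elim (z∉C y∈C)
  ... | no _ | no y∉C′ | here refl = ⊥-elim (y∉C′ z∈C′)
  ... | no _ | yes _ | here refl = s≤s (uncovered-antimono C⊆C′ zs)
  ... | yes _ | yes _ | there z∈zs′ = uncovered-strict C⊆C′ zs z∈zs′ z∉C z∈C′
  ... | no _ | yes _ | there z∈zs′ = m≤n⇒m≤1+n (uncovered-strict C⊆C′ zs z∈zs′ z∉C z∈C′)
  ... | no _ | no _ | there z∈zs′ = s≤s (uncovered-strict C⊆C′ zs z∈zs′ z∉C z∈C′)

  uncovered-∷-∈ : ∀ {C z} zs → z ∈ C → uncovered C (z ∷ zs) ≡ uncovered C zs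
  uncovered-∷-∈ {C} {z} zs z∈C with z ∈? C
  ... | yes _ = refl
  ... | no z∉C = ⊥-elim (z∉C z∈C)

  uncovered-∷-≤ : ∀ C z zs → uncovered C (z ∷ zs) ≤ suc (uncovered C zs)
  uncovered-∷-≤ C z zs with z ∈? C
  ... | yes _ = n≤1+n _
  ... | no _ = ≤-refl

  IsMatchingQ : List (Edge d) → Set
  IsMatchingQ N = IsMatchingK N × All (λ e → AdjQ (proj₁ e) (proj₂ e)) N

  totalLen-matchingQ : ∀ {N} → IsMatchingQ N → totalLen N ≡ length N
  totalLen-matchingQ {[]} _ = refl
  totalLen-matchingQ {e ∷ N} ((_ ∷ nondeg , _ ∷ _ ∷ unique) , adj ∷ adjs)
    rewrite adj = cong suc (totalLen-matchingQ ((nondeg , unique) , adjs))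

  Free : List (Edge d) → Edge d → Set
  Free N (x , y) = AdjQ x y × x ∉ ends N × y ∉ ends N

  free? : ∀ N e → Dec (Free N e)
  free? N (x , y) = (dist x y ≟ 1) ×-dec (¬? (x ∈? ends N) ×-dec ¬? (y ∈? ends N))

  extend : List (Edge d) → Edge d → List (Edge d)
  extend N e with free? N e
  ... | yes _ = e ∷ N
  ... | no _ = N

  ends-extend-⊇ : ∀ N e → ends N ⊆ ends (extend N e)
  ends-extend-⊇ N e z∈N with free? N e
  ... | yes _ = there (there z∈N)
  ... | no _ = z∈N

  extend-matchingQ : ∀ {N} e → IsMatchingQ N → IsMatchingQ (extend N e)
  extend-matchingQ {N} (x , y) ((nondeg , unique) , adjs) with free? N (x , y)
  ... | no _ = (nondeg , unique) , adjs
  ... | yes (adj , x∉N , y∉N) =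
    ( (adjacent⇒≢ adj ∷ nondeg)
    , (adjacent⇒≢ adj ∷ ¬Any⇒All¬ _ x∉N) ∷ ¬Any⇒All¬ _ y∉N ∷ unique )
    , adj ∷ adjs

  extend-covers : ∀ N {x y} → AdjQ x y → x ∈ ends (extend N (x , y)) ⊎ y ∈ ends (extend N (x , y))
  extend-covers N {x} {y} adj with free? N (x , y)
  ... | yes _ = inj₁ (here refl)
  ... | no ¬free with x ∈? ends N | y ∈? ends N
  ...   | yes x∈N | _ = inj₁ x∈N
  ...   | no _ | yes y∈N = inj₂ y∈N
  ...   | no x∉N | no y∉N = ⊥-elim (¬free (adj , x∉N , y∉N))

  potential : List (Edge d) → List (Edge d) → ℕ
  potential M N = length N + uncovered (ends N) (ends M)

  extend-potential : ∀ M → CoversQ M → ∀ N e → potential M (extend N e) ≤ potential M N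
  extend-potential M covers N (x , y) with free? N (x , y)
  ... | no _ = ≤-refl
  ... | yes (adj , x∉N , y∉N) = +-monoʳ-< (length N) uncovered-drops
    where
      N⊆xyN : ends N ⊆ x ∷ y ∷ ends N
      N⊆xyN z∈N = there (there z∈N)
      uncovered-drops : uncovered (x ∷ y ∷ ends N) (ends M) < uncovered (ends N) (ends M)
      uncovered-drops with covers x y adj
      ... | inj₁ x∈M = uncovered-strict N⊆xyN (ends M) x∈M x∉N (here refl)
      ... | inj₂ y∈M = uncovered-strict N⊆xyN (ends M) y∈M y∉N (there (here refl))

  greedy : List (Edge d) → List (Edge d) → List (Edge d)
  greedy = foldl extend

  ends-greedy-⊇ : ∀ N es → ends N ⊆ ends (greedy N es)
  ends-greedy-⊇ N [] = λ z∈N → z∈N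
  ends-greedy-⊇ N (e ∷ es) z∈N = ends-greedy-⊇ (extend N e) es (ends-extend-⊇ N e z∈N)

  greedy-matchingQ : ∀ {N} es → IsMatchingQ N → IsMatchingQ (greedy N es)
  greedy-matchingQ [] m = m
  greedy-matchingQ (e ∷ es) m = greedy-matchingQ es (extend-matchingQ e m)

  greedy-covers : ∀ N {es x y} → (x , y) ∈ es → AdjQ x y →
                  x ∈ ends (greedy N es) ⊎ y ∈ ends (greedy N es)
  greedy-covers N {_ ∷ es} (there xy∈es) adj = greedy-covers _ xy∈es adj
  greedy-covers N {(x , y) ∷ es} (here refl) adj with extend-covers N adj
  ... | inj₁ x∈ = inj₁ (ends-greedy-⊇ _ es x∈)
  ... | inj₂ y∈ = inj₂ (ends-greedy-⊇ _ es y∈)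

  greedy-potential : ∀ M → CoversQ M → ∀ N es → potential M (greedy N es) ≤ potential M N
  greedy-potential M covers N [] = ≤-refl
  greedy-potential M covers N (e ∷ es) =
    ≤-trans (greedy-potential M covers (extend N e) es) (extend-potential M covers N e)

  allEdges : List (Edge d)
  allEdges = cartesianProduct (vertices d) (vertices d)

  maximalise : List (Edge d) → List (Edge d)
  maximalise N = greedy N allEdges

  maximalise-matchingQ : ∀ {N} → IsMatchingQ N → IsMatchingQ (maximalise N)
  maximalise-matchingQ = greedy-matchingQ allEdges

  maximalise-covers : ∀ N → CoversQ (maximalise N)
  maximalise-covers N x y = greedy-covers N (∈-cartesianProduct⁺ (∈-vertices x) (∈-vertices y))

  maximalise-potential : ∀ M → CoversQ M → ∀ N → potential M (maximalise N) ≤ potential M N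
  maximalise-potential M covers N = greedy-potential M covers N allEdges

  short? : (e : Edge d) → Dec (len e ≡ 1)
  short? e = len e ≟ 1

  shortEdges : List (Edge d) → List (Edge d)
  shortEdges = filter short?

  module _ {P : Edge d → Set} (P? : Decidable P) where

    ends-filter-⊆ : ∀ L → ends (filter P? L) ⊆ ends L
    ends-filter-⊆ (e ∷ L) z∈F with does (P? e) | z∈F
    ... | false | z∈F′ = there (there (ends-filter-⊆ L z∈F′))
    ... | true | here refl = here refl
    ... | true | there (here refl) = there (here refl)
    ... | true | there (there z∈F′) = there (there (ends-filter-⊆ L z∈F′))

    unique-ends-filter : ∀ L → Unique (ends L) → Unique (ends (filter P? L))
    unique-ends-filter [] _ = []
    unique-ends-filter (e ∷ L) (x∉ ∷ y∉ ∷ unique) with does (P? e)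
    ... | false = unique-ends-filter L unique
    ... | true = (All.head x∉ ∷ anti-mono (ends-filter-⊆ L) (All.tail x∉))
               ∷ anti-mono (ends-filter-⊆ L) y∉
               ∷ unique-ends-filter L unique

    filter-matchingK : ∀ {L} → IsMatchingK L → IsMatchingK (filter P? L)
    filter-matchingK {L} (nondeg , unique) = filter⁺ P? nondeg , unique-ends-filter L unique

  shortEdges-matchingQ : ∀ {L} → IsMatchingK L → IsMatchingQ (shortEdges L)
  shortEdges-matchingQ {L} matching = filter-matchingK short? matching , all-filter short? L

  -- A short edge contributes 1 to both sides; a long edge at most 2 to the
  -- left and at least 2 to the right.
  shortEdges-potential : ∀ C L → All (λ e → proj₁ e ≢ proj₂ e) L →
    All (λ e → len e ≡ 1 → proj₁ e ∈ C × proj₂ e ∈ C) L →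
    length (shortEdges L) + uncovered C (ends L) ≤ totalLen L
  shortEdges-potential C [] _ _ = z≤n
  shortEdges-potential C ((u , v) ∷ L) (u≢v ∷ nondeg) (short⇒∈C ∷ shorts⇒∈C)
    with short? (u , v)
  ... | yes short = begin
      length (shortEdges ((u , v) ∷ L)) + uncovered C (u ∷ v ∷ ends L)
        ≡⟨ cong (λ S′ → length S′ + uncovered C (u ∷ v ∷ ends L)) (filter-accept short? {x = u , v} {L} short) ⟩
      suc (length S + uncovered C (u ∷ v ∷ ends L))
        ≡⟨ cong (λ n → suc (length S + n)) uncovered-short ⟩
      suc (length S + uncovered C (ends L)) ≤⟨ s≤s IH ⟩
      suc (totalLen L)                       ≡⟨ cong (_+ totalLen L) (sym short) ⟩
      dist u v + totalLen L                  ∎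
    where
      open ≤-Reasoning
      S = shortEdges L
      IH = shortEdges-potential C L nondeg shorts⇒∈C
      uncovered-short : uncovered C (u ∷ v ∷ ends L) ≡ uncovered C (ends L)
      uncovered-short = trans (uncovered-∷-∈ (v ∷ ends L) (proj₁ (short⇒∈C short)))
                              (uncovered-∷-∈ (ends L) (proj₂ (short⇒∈C short)))
  ... | no long = begin
      length (shortEdges ((u , v) ∷ L)) + uncovered C (u ∷ v ∷ ends L)
        ≡⟨ cong (λ S′ → length S′ + uncovered C (u ∷ v ∷ ends L)) (filter-reject short? {x = u , v} {L} long) ⟩
      length S + uncovered C (u ∷ v ∷ ends L)
        ≤⟨ +-monoʳ-≤ (length S) (≤-trans (uncovered-∷-≤ C u _) (s≤s (uncovered-∷-≤ C v _))) ⟩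
      length S + (2 + uncovered C (ends L))  ≡⟨ +-suc (length S) _ ⟩
      suc (length S + (1 + uncovered C (ends L))) ≡⟨ cong suc (+-suc (length S) _) ⟩
      2 + (length S + uncovered C (ends L))  ≤⟨ +-mono-≤ (≢∧¬adjacent⇒2≤dist u≢v long) IH ⟩
      dist u v + totalLen L                  ∎
    where
      open ≤-Reasoning
      S = shortEdges L
      IH = shortEdges-potential C L nondeg shorts⇒∈C

lemma18 : (d : ℕ) (M : List (Edge d)) → IsMaximalMatchingK M →
    Σ (List (Edge d)) (λ M′ → IsMaximalMatchingQ M′ × totalLen M ≥ totalLen M′)
lemma18 d M (matching@(nondeg , _) , covers) =
  M′ , (proj₁ matchingQ′ , proj₂ matchingQ′ , maximalise-covers S) , ℓM′≤ℓM
  where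
    open ≤-Reasoning
    S = shortEdges M
    M′ = maximalise S
    matchingQ′ : IsMatchingQ M′
    matchingQ′ = maximalise-matchingQ (shortEdges-matchingQ matching)
    ends-short∈S : All (λ e → len e ≡ 1 → proj₁ e ∈ ends S × proj₂ e ∈ ends S) M
    ends-short∈S = All.tabulate λ e∈M short →
      ∈⇒proj₁∈ends (∈-filter⁺ _ e∈M short) , ∈⇒proj₂∈ends (∈-filter⁺ _ e∈M short)
    ℓM′≤ℓM : totalLen M′ ≤ totalLen M
    ℓM′≤ℓM = begin
      totalLen M′     ≡⟨ totalLen-matchingQ matchingQ′ ⟩
      length M′       ≤⟨ m≤m+n _ _ ⟩
      potential M M′  ≤⟨ maximalise-potential M covers S ⟩
      potential M S   ≤⟨ shortEdges-potential (ends S) M nondeg ends-short∈S ⟩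
      totalLen M      ∎
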